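{- Let $m,j,k\in\mathbb{N}$ with $m\geq 4$, $1\leq j<\frac{m}{2}$, and $1\leq k\leq\frac{m}{2}$. The generalized Pappus graph $P(m,j,k)$ is 3-balanced if and only if $6\mid m$, $3\nmid j$, and $k=\frac{m}{2}$.
   Context: The generalized Pappus graph $P(m,j,k)$ is the simple graph with vertex set $\{v_i,u_i,w_i : i\in\mathbb{Z}_m\}$ and edges $v_iv_{i+1}$, $v_iu_i$, $u_iw_{i+j}$, $u_iw_{i-j}$, and $w_iw_{i+k}$ for $i\in\mathbb{Z}_m$. A graph is 3-balanced if it admits a vertex coloring $\ell:V\to\mathbb{Z}_3$ such that every vertex has, in its open neighborhood, the same number of vertices of each of the three colors. -}

module Defs where

open import Data.Nat using (ℕ; zero; suc; _+_; _%_; _≡ᵇ_)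
open import Data.Bool using (Bool; true; false; _∧_; _∨_; if_then_else_)
open import Data.Fin using (Fin; toℕ) renaming (zero to f0; suc to fs)
open import Data.Fin.Properties using () renaming (_≟_ to _≟ᶠ_)
open import Data.List using (List; length; filter; allFin; cartesianProduct)
open import Data.Product using (_×_; _,_)
open import Relation.Nullary.Decidable using (⌊_⌋)
open import Relation.Binary.PropositionalEquality using (_≡_)

-- Boolean congruence a ≡ b (mod m), used only with m ≥ 4
_≡ᵇ_[mod_] : ℕ → ℕ → ℕ → Bool
a ≡ᵇ b [mod zero ] = a ≡ᵇ b
a ≡ᵇ b [mod suc n ] = (a % suc n) ≡ᵇ (b % suc n)

-- A finite simple graph: a finite list enumerating all vertices
-- (each exactly once) and a boolean adjacency relation.
record FinGraph : Set₁ where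
  field
    V     : Set
    verts : List V
    adj   : V → V → Bool

-- vertex kinds of P(m,j,k): 0 ↦ v, 1 ↦ u, 2 ↦ w ; vertex (t , i) is t_i, i ∈ ℤ_m

PVertex : ℕ → Set
PVertex m = Fin 3 × Fin m

-- directed generating edges  v_i v_{i+1}, v_i u_i, u_i w_{i+j}, u_i w_{i-j}, w_i w_{i+k}
pappusGen : (m j k : ℕ) → PVertex m → PVertex m → Bool
pappusGen m j k (f0 , a) (f0 , b) = toℕ b ≡ᵇ toℕ a + 1 [mod m ]
pappusGen m j k (f0 , a) (fs f0 , b) = toℕ b ≡ᵇ toℕ a [mod m ]
pappusGen m j k (fs f0 , a) (fs (fs f0) , b) =
  (toℕ b ≡ᵇ toℕ a + j [mod m ]) ∨ (toℕ a ≡ᵇ toℕ b + j [mod m ])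
pappusGen m j k (fs (fs f0) , a) (fs (fs f0) , b) =
  toℕ b ≡ᵇ toℕ a + k [mod m ]
pappusGen m j k _ _ = false

pappus : ℕ → ℕ → ℕ → FinGraph
pappus m j k = record
  { V     = PVertex m
  ; verts = cartesianProduct (allFin 3) (allFin m)
  ; adj   = λ x y → pappusGen m j k x y ∨ pappusGen m j k y x
  }

nbrCount : (G : FinGraph) → (FinGraph.V G → Fin 3) → FinGraph.V G → Fin 3 → ℕ
nbrCount G ℓ x c =
  length (filter (λ y → Data.Bool._≟_ (adj x y ∧ ⌊ ℓ y ≟ᶠ c ⌋) true) verts)
  where open FinGraph G
        import Data.Bool

ThreeBalanced : FinGraph → Set
ThreeBalanced G = Data.Product.Σ (FinGraph.V G → Fin 3) λ ℓ →
  ∀ x c c' → nbrCount G ℓ x c ≡ nbrCount G ℓ x c'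
  where import Data.Product

module Submission where

open import Defs
open import Data.Nat using (ℕ; _≤_; _<_; _*_)
open import Data.Nat.Divisibility using (_∣_)
open import Data.Product using (_×_)
open import Relation.Nullary using (¬_)
open import Relation.Binary.PropositionalEquality using (_≡_)
open import Function.Bundles using (_⇔_)

open import Data.Bool using (true; false; _∧_; _∨_)
import Data.Bool as Bool
open import Data.Bool.Properties using (T-≡; ∨-zeroʳ; ∨-identityʳ)
open import Data.Empty using (⊥-elim)
open import Data.Fin using (Fin; toℕ)
open import Data.Fin.Patterns using (0F; 1F; 2F)
open import Data.Fin.Properties using (_≟_; all?; toℕ-injective; toℕ-fromℕ<; toℕ<n)
open import Data.List using (List; []; _∷_; length; filter; map)
open import Data.List.Membership.Propositional using (_∈_)
open import Data.List.Membership.Propositional.Properties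
  using (∈-filter⁺; ∈-filter⁻; ∈-cartesianProduct⁺; ∈-allFin)
open import Data.List.Membership.Propositional.Properties.WithK using (unique∧set⇒bag)
open import Data.List.Relation.Binary.BagAndSetEquality using (∼bag⇒↭)
open import Data.List.Relation.Binary.Permutation.Propositional.Properties using (↭-length)
open import Data.List.Relation.Unary.Any using (here; there)
open import Data.List.Relation.Unary.Unique.Propositional using (Unique)
open import Data.List.Relation.Unary.Unique.Propositional.Properties using (filter⁺; cartesianProduct⁺; allFin⁺)
open import Data.Nat using (zero; suc; _+_; _∸_; _%_; _/_; _≡ᵇ_; NonZero; >-nonZero; s≤s; z≤n)
open import Data.Nat.DivMod
  using (_mod_; m≡m%n+[m/n]*n; m%n<n; m%n%n≡m%n; [m+n]%n≡m%n; %-distribˡ-+; m<n⇒m%n≡m; m∣n⇒o%n%m≡o%m)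
open import Data.Nat.Divisibility using (divides; m%n≡0⇒n∣m; n∣m⇒m%n≡0; ∣-trans; _∣?_)
import Data.Nat.Properties as ℕ
open import Data.Nat.Tactic.RingSolver using (solve; solve-∀)
open import Data.Product using (_,_; proj₂; uncurry)
open import Data.Sum using (inj₁; inj₂)
open import Function using (_∘_)
open import Function.Bundles using (Equivalence; mk⇔)
import Function.Properties.Equivalence as ⇔
open import Relation.Binary.PropositionalEquality
  using (_≢_; _≗_; refl; sym; trans; cong; cong₂; subst; module ≡-Reasoning)
open import Relation.Nullary using (Dec; ¬?; does)
open import Relation.Nullary.Decidable
  using (⌊_⌋; isYes≗does; dec-true; toWitness; from-yes; from-no; map′; _×-dec_; _→-dec_)
open import Relation.Unary using (Decidable)

open Equivalence using (to; from)

-- In a 3-balanced graph a vertex of degree d sees every colour d/3 times.  So w_i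
-- cannot have the four distinct neighbours it has when 2k < m, hence 2k = m; the
-- graph is then cubic and every neighbourhood is rainbow.  Read the colours of
-- v_n, u_n, w_n as m-periodic functions A, B, C of n ∈ ℕ.  The rainbow conditions
-- at u and w give B(n) = A(n + k); those at v_{n+1} and v_{n+k+2} then force
-- A(n + k + 3) = A(n), so A has period 6 although A(n + 2) ≠ A(n).  Together with
-- the period 2k this gives 3 ∣ k, i.e. 6 ∣ m, and 3 ∣ j would make B(n + 2j) = B(n),
-- against the rainbow condition at w_{n+j}.  Conversely, colouring t_i by i mod 3
-- makes the neighbourhood {i + δ, i − δ, i + ε} of every vertex rainbow, since
-- δ ∈ {1, j} is prime to 3 and ε ∈ {0, k} is divisible by 3.

occ : Fin 3 → List (Fin 3) → ℕ
occ c cs = length (filter (_≟ c) cs)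

Balanced : List (Fin 3) → Set
Balanced cs = ∀ c c' → occ c cs ≡ occ c' cs

balanced? : ∀ cs → Dec (Balanced cs)
balanced? cs = all? λ c → all? λ c' → occ c cs ℕ.≟ occ c' cs

occ-total : ∀ cs → occ 0F cs + occ 1F cs + occ 2F cs ≡ length cs
occ-total []        = refl
occ-total (0F ∷ cs) = cong suc (occ-total cs)
occ-total (1F ∷ cs) = trans (cong (_+ occ 2F cs) (ℕ.+-suc (occ 0F cs) _)) (cong suc (occ-total cs))
occ-total (2F ∷ cs) = trans (ℕ.+-suc (occ 0F cs + occ 1F cs) _) (cong suc (occ-total cs))

balanced⇒3∣length : ∀ {cs} → Balanced cs → 3 ∣ length cs
balanced⇒3∣length {cs} bal = divides (occ 0F cs) (begin
  length cs                          ≡⟨ occ-total cs ⟨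
  occ 0F cs + occ 1F cs + occ 2F cs  ≡⟨ cong₂ (λ x y → occ 0F cs + x + y) (bal 1F 0F) (bal 2F 0F) ⟩
  occ 0F cs + occ 0F cs + occ 0F cs  ≡⟨ thrice (occ 0F cs) ⟩
  occ 0F cs * 3                      ∎)
  where
  open ≡-Reasoning
  thrice : ∀ o → o + o + o ≡ o * 3
  thrice = solve-∀

record Rainbow (p q r : Fin 3) : Set where
  constructor rainbow
  field
    1≢2 : p ≢ q
    1≢3 : p ≢ r
    2≢3 : q ≢ r

open Rainbow

rainbow? : ∀ p q r → Dec (Rainbow p q r)
rainbow? p q r = map′ (λ (p≢q , p≢r , q≢r) → rainbow p≢q p≢r q≢r)
                      (λ rb → 1≢2 rb , 1≢3 rb , 2≢3 rb)
                      (¬? (p ≟ q) ×-dec ¬? (p ≟ r) ×-dec ¬? (q ≟ r))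

balanced⇒rainbow : ∀ p q r → Balanced (p ∷ q ∷ r ∷ []) → Rainbow p q r
balanced⇒rainbow = from-yes (all? λ p → all? λ q → all? λ r →
  balanced? (p ∷ q ∷ r ∷ []) →-dec rainbow? p q r)

rainbow⇒balanced : ∀ p q r → Rainbow p q r → Balanced (p ∷ q ∷ r ∷ [])
rainbow⇒balanced = from-yes (all? λ p → all? λ q → all? λ r →
  rainbow? p q r →-dec balanced? (p ∷ q ∷ r ∷ []))

rainbow-third : ∀ {p q r w} → Rainbow p q r → w ≢ p → w ≢ q → w ≡ r
rainbow-third {p} {q} {r} {w} = from-yes (all? λ p → all? λ q → all? λ r → all? λ w →
  rainbow? p q r →-dec ¬? (w ≟ p) →-dec ¬? (w ≟ q) →-dec w ≟ r) p q r w

rainbow-swap : ∀ {p q r} → Rainbow p q r → Rainbow p r q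
rainbow-swap (rainbow p≢q p≢r q≢r) = rainbow p≢r p≢q (q≢r ∘ sym)

rainbow-subst : ∀ {p q r p' q' r'} → Rainbow p q r → p ≡ p' → q ≡ q' → r ≡ r' → Rainbow p' q' r'
rainbow-subst rb refl refl refl = rb

toℕ-mod : ∀ n d .{{_ : NonZero d}} → toℕ (n mod d) ≡ n % d
toℕ-mod n d = toℕ-fromℕ< (m%n<n n d)

ν : ℕ → Fin 3
ν n = n mod 3

infixl 6 _+₃_

_+₃_ : Fin 3 → Fin 3 → Fin 3
x +₃ y = (toℕ x + toℕ y) mod 3

+₃-identityʳ : ∀ x → x +₃ 0F ≡ x
+₃-identityʳ 0F = refl
+₃-identityʳ 1F = refl
+₃-identityʳ 2F = refl

ν-+ : ∀ a b → ν (a + b) ≡ ν a +₃ ν b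
ν-+ a b = toℕ-injective (begin
  toℕ (ν (a + b))              ≡⟨ toℕ-mod (a + b) 3 ⟩
  (a + b) % 3                  ≡⟨ %-distribˡ-+ a b 3 ⟩
  (a % 3 + b % 3) % 3          ≡⟨ cong₂ (λ x y → (x + y) % 3) (toℕ-mod a 3) (toℕ-mod b 3) ⟨
  (toℕ (ν a) + toℕ (ν b)) % 3  ≡⟨ toℕ-mod (toℕ (ν a) + toℕ (ν b)) 3 ⟨
  toℕ (ν a +₃ ν b)             ∎)
  where open ≡-Reasoning

ν≡0⇔3∣ : ∀ n → ν n ≡ 0F ⇔ 3 ∣ n
ν≡0⇔3∣ n = mk⇔ (λ e → m%n≡0⇒n∣m n 3 (trans (sym (toℕ-mod n 3)) (cong toℕ e)))
               (λ 3∣n → toℕ-injective (trans (toℕ-mod n 3) (n∣m⇒m%n≡0 n 3 3∣n)))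

rainbow-translate : ∀ c δ δ' → δ ≢ 0F → δ +₃ δ' ≡ 0F → Rainbow (c +₃ δ) (c +₃ δ') c
rainbow-translate = from-yes (all? λ c → all? λ δ → all? λ δ' →
  ¬? (δ ≟ 0F) →-dec δ +₃ δ' ≟ 0F →-dec rainbow? (c +₃ δ) (c +₃ δ') c)

3∣k⇔6∣k+k : ∀ k → 3 ∣ k ⇔ 6 ∣ k + k
3∣k⇔6∣k+k k = mk⇔ double halve
  where
  open ≡-Reasoning
  double : 3 ∣ k → 6 ∣ k + k
  double (divides q k≡q*3) = divides q (trans (cong₂ _+_ k≡q*3 k≡q*3) (solve (q ∷ [])))
  halve : 6 ∣ k + k → 3 ∣ k
  halve (divides q k+k≡q*6) = divides q (ℕ.*-cancelˡ-≡ k (q * 3) 2 (begin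
    2 * k        ≡⟨ solve (k ∷ []) ⟩
    k + k        ≡⟨ k+k≡q*6 ⟩
    q * 6        ≡⟨ solve (q ∷ []) ⟩
    2 * (q * 3)  ∎))

Periodic : {A : Set} → ℕ → (ℕ → A) → Set
Periodic p f = ∀ n → f (n + p) ≡ f n

module _ {A : Set} {f : ℕ → A} where

  periodic-cong : ∀ {p x y} → Periodic p f → x ≡ y + p → f x ≡ f y
  periodic-cong {y = y} per x≡y+p = trans (cong f x≡y+p) (per y)

  periodic-+ : ∀ {p q} → Periodic p f → Periodic q f → Periodic (p + q) f
  periodic-+ {p} {q} per-p per-q n =
    trans (cong f (sym (ℕ.+-assoc n p q))) (trans (per-q (n + p)) (per-p n))

  periodic-* : ∀ {p} → Periodic p f → ∀ t → Periodic (t * p) f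
  periodic-* per zero    n = cong f (ℕ.+-identityʳ n)
  periodic-* per (suc t)   = periodic-+ per (periodic-* per t)

  periodic-drop : ∀ {p q} t → Periodic p f → Periodic (q + t * p) f → Periodic q f
  periodic-drop {p} {q} t per-p per n =
    trans (sym (periodic-* per-p t (n + q))) (trans (cong f (ℕ.+-assoc n q (t * p))) (per n))

  periodic-shift : ∀ {p} d → Periodic p f → Periodic p (λ n → f (n + d))
  periodic-shift {p} d per n = periodic-cong per (solve (n ∷ p ∷ d ∷ []))

  periodic-reindex : ∀ {p d} {g : ℕ → A} → Periodic p f → Periodic p g → d ≤ p →
                     (∀ n → f (n + d) ≡ g (n + d)) → f ≗ g
  periodic-reindex {p} {d} {g} per-f per-g d≤p f≡g x = begin
    f x                  ≡⟨ per-f x ⟨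
    f (x + p)            ≡⟨ cong f x+p≡ ⟩
    f (x + (p ∸ d) + d)  ≡⟨ f≡g (x + (p ∸ d)) ⟩
    g (x + (p ∸ d) + d)  ≡⟨ cong g x+p≡ ⟨
    g (x + p)            ≡⟨ per-g x ⟩
    g x                  ∎
    where
    open ≡-Reasoning
    x+p≡ : x + p ≡ x + (p ∸ d) + d
    x+p≡ = trans (cong (x +_) (sym (ℕ.m∸n+n≡m d≤p))) (sym (ℕ.+-assoc x (p ∸ d) d))

-- A, B, C colour v_n, u_n, w_n; the hypotheses are the neighbourhoods of v_{n+1}, u_{n+j}, w_{n+j}.
module RainbowConstraints
  {A B C : ℕ → Fin 3} {j k : ℕ}
  (A-periodic : Periodic (k + k) A) (B-periodic : Periodic (k + k) B) (C-periodic : Periodic (k + k) C)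
  (j+j≤k+k : j + j ≤ k + k)
  (rainbow-V : ∀ n → Rainbow (A (n + 2)) (A n) (B (n + 1)))
  (rainbow-U : ∀ n → Rainbow (C (n + j + j)) (C n) (A (n + j)))
  (rainbow-W : ∀ n → Rainbow (B (n + j + j)) (B n) (C (n + j + k)))
  where

  B-shift : ∀ n → B (n + (j + j) + k) ≡ A (n + (j + j))
  B-shift n = rainbow-third U₀ (2≢3 W₁) (1≢3 W₂)
    where
    U₀ : Rainbow (C (n + j + j + j)) (C (n + j)) (A (n + (j + j)))
    U₀ = rainbow-subst (rainbow-U (n + j)) refl refl (cong A (ℕ.+-assoc n j j))
    W₁ : Rainbow (B (n + (j + j) + k + j + j)) (B (n + (j + j) + k)) (C (n + j + j + j))
    W₁ = rainbow-subst (rainbow-W (n + (j + j) + k)) refl refl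
      (periodic-cong C-periodic (solve (n ∷ j ∷ k ∷ [])))
    W₂ : Rainbow (B (n + (j + j) + k)) (B (n + k)) (C (n + j))
    W₂ = rainbow-subst (rainbow-W (n + k)) (cong B (solve (n ∷ j ∷ k ∷ []))) refl
      (periodic-cong C-periodic (solve (n ∷ j ∷ k ∷ [])))

  B≡A+k : ∀ n → B n ≡ A (n + k)
  B≡A+k n = trans (sym (periodic-cong B-periodic (ℕ.+-assoc n k k)))
    (periodic-reindex (periodic-shift k B-periodic) A-periodic j+j≤k+k B-shift (n + k))

  rainbow-A : ∀ n → Rainbow (A (n + 2)) (A n) (A (n + 1 + k))
  rainbow-A n = rainbow-subst (rainbow-V n) refl refl (B≡A+k (n + 1))

  A-step : ∀ n → A (n + k + 3) ≡ A n
  A-step n = rainbow-third (rainbow-swap (rainbow-A n)) (1≢3 A₁) (1≢2 A₁)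
    where
    A₁ : Rainbow (A (n + k + 3)) (A (n + 1 + k)) (A (n + 2))
    A₁ = rainbow-subst (rainbow-A (n + k + 1)) (cong A (solve (n ∷ k ∷ []))) (cong A (solve (n ∷ k ∷ [])))
      (periodic-cong A-periodic (solve (n ∷ k ∷ [])))

  A-periodic-6 : Periodic 6 A
  A-periodic-6 n = begin
    A (n + 6)              ≡⟨ periodic-cong A-periodic (solve (n ∷ k ∷ [])) ⟨
    A (n + k + 3 + k + 3)  ≡⟨ A-step (n + k + 3) ⟩
    A (n + k + 3)          ≡⟨ A-step n ⟩
    A n                    ∎
    where open ≡-Reasoning

  A+2≢A : ∀ n → A (n + 2) ≢ A n
  A+2≢A n = 1≢2 (rainbow-A n)

  -- 2 (k % 3) ∈ {0, 2, 4} is a period of A; 2 contradicts A+2≢A, and so does 4,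
  -- which together with 6 would give the period 2.
  k%3≡0 : k % 3 ≡ 0
  k%3≡0 with k % 3 | m%n<n k 3 | periodic-drop (k / 3) A-periodic-6 (subst (λ p → Periodic p A) k+k≡ A-periodic)
    where
    k+k≡ : k + k ≡ k % 3 + k % 3 + k / 3 * 6
    k+k≡ = trans (cong₂ _+_ k≡ k≡) (regroup (k % 3) (k / 3))
      where
      k≡ : k ≡ k % 3 + k / 3 * 3
      k≡ = m≡m%n+[m/n]*n k 3
      regroup : ∀ r q → r + q * 3 + (r + q * 3) ≡ r + r + q * 6
      regroup = solve-∀
  ... | 0 | _ | _ = refl
  ... | 1 | _ | periodic-2 = ⊥-elim (A+2≢A 0 (periodic-2 0))
  ... | 2 | _ | periodic-4 = ⊥-elim (A+2≢A 0 (periodic-drop 1 periodic-4 A-periodic-6 0))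
  ... | suc (suc (suc _)) | s≤s (s≤s (s≤s ())) | _

  B-periodic-6 : Periodic 6 B
  B-periodic-6 n = trans (B≡A+k (n + 6)) (trans (periodic-shift k A-periodic-6 n) (sym (B≡A+k n)))

  3∣k : 3 ∣ k
  3∣k = m%n≡0⇒n∣m k 3 k%3≡0

  3∤j : ¬ 3 ∣ j
  3∤j (divides s j≡s*3) = 1≢2 (rainbow-W 0) (periodic-cong (periodic-* B-periodic-6 s) j+j≡s*6)
    where
    j+j≡s*6 : j + j ≡ s * 6
    j+j≡s*6 = trans (cong₂ _+_ j≡s*3 j≡s*3) (solve (s ∷ []))

module _ {A : Set} where
  open import Data.List.Relation.Unary.All using ([]; _∷_)
  open import Data.List.Relation.Unary.AllPairs using ([]; _∷_)

  unique₃ : ∀ {p q r : A} → p ≢ q → p ≢ r → q ≢ r → Unique (p ∷ q ∷ r ∷ [])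
  unique₃ p≢q p≢r q≢r = (p≢q ∷ p≢r ∷ []) ∷ (q≢r ∷ []) ∷ [] ∷ []

  unique₄ : ∀ {p q r s : A} → p ≢ q → p ≢ r → p ≢ s → q ≢ r → q ≢ s → r ≢ s →
            Unique (p ∷ q ∷ r ∷ s ∷ [])
  unique₄ p≢q p≢r p≢s q≢r q≢s r≢s = (p≢q ∷ p≢r ∷ p≢s ∷ []) ∷ (q≢r ∷ q≢s ∷ []) ∷ (r≢s ∷ []) ∷ [] ∷ []

∈-dedup : ∀ {A : Set} {p q r r' y : A} → r' ≡ r →
          y ∈ p ∷ q ∷ r ∷ r' ∷ [] ⇔ y ∈ p ∷ q ∷ r ∷ []
∈-dedup r'≡r = mk⇔
  (λ { (here y≡p)                         → here y≡p
     ; (there (here y≡q))                 → there (here y≡q)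
     ; (there (there (here y≡r)))         → there (there (here y≡r))
     ; (there (there (there (here y≡r')))) → there (there (here (trans y≡r' r'≡r)))
     ; (there (there (there (there ())))) })
  (λ { (here y≡p)                 → here y≡p
     ; (there (here y≡q))         → there (here y≡q)
     ; (there (there (here y≡r))) → there (there (here y≡r)) })

module _ {A : Set} {P Q : A → Set} (P? : Decidable P) (Q? : Decidable Q) where

  unique-filter-length : ∀ {xs ys} → Unique xs → Unique ys →
                         (∀ {y} → (y ∈ xs × P y) ⇔ (y ∈ ys × Q y)) →
                         length (filter P? xs) ≡ length (filter Q? ys)
  unique-filter-length xs-unique ys-unique same =
    ↭-length (∼bag⇒↭ (unique∧set⇒bag (filter⁺ P? xs-unique) (filter⁺ Q? ys-unique) (mk⇔
      (λ y∈ → uncurry (∈-filter⁺ Q?) (to same (∈-filter⁻ P? y∈)))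
      (λ y∈ → uncurry (∈-filter⁺ P?) (from same (∈-filter⁻ Q? y∈))))))

occ-map : ∀ {A : Set} (f : A → Fin 3) c xs → occ c (map f xs) ≡ length (filter (λ x → f x ≟ c) xs)
occ-map f c []       = refl
occ-map f c (x ∷ xs) with does (f x ≟ c)
... | true  = cong suc (occ-map f c xs)
... | false = occ-map f c xs

∧-≡-true⁻ : ∀ a {b} → (a ∧ b) ≡ true → a ≡ true × b ≡ true
∧-≡-true⁻ true b≡true = refl , b≡true

∨-≡-trueˡ : ∀ {a} b → a ≡ true → (a ∨ b) ≡ true
∨-≡-trueˡ b refl = refl

∨-≡-trueʳ : ∀ a {b} → b ≡ true → (a ∨ b) ≡ true
∨-≡-trueʳ a refl = ∨-zeroʳ a

module _ (G : FinGraph) where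

  open FinGraph G using (verts; adj)

  nbrCount≡occ : Unique verts → (∀ y → y ∈ verts) →
                 ∀ {x ns} → Unique ns → (∀ y → adj x y ≡ true ⇔ y ∈ ns) →
                 ∀ ℓ c → nbrCount G ℓ x c ≡ occ c (map ℓ ns)
  nbrCount≡occ verts-unique verts-complete {x} {ns} ns-unique adj⇔∈ ℓ c =
    trans (unique-filter-length P? (λ y → ℓ y ≟ c) verts-unique ns-unique same) (sym (occ-map ℓ c ns))
    where
    P? : Decidable (λ y → (adj x y ∧ ⌊ ℓ y ≟ c ⌋) ≡ true)
    P? y = (adj x y ∧ ⌊ ℓ y ≟ c ⌋) Bool.≟ true
    same : ∀ {y} → (y ∈ verts × (adj x y ∧ ⌊ ℓ y ≟ c ⌋) ≡ true) ⇔ (y ∈ ns × ℓ y ≡ c)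
    same {y} = mk⇔
      (λ (_ , e) → let adj≡true , coloured = ∧-≡-true⁻ (adj x y) e
        in to (adj⇔∈ y) adj≡true , toWitness {a? = ℓ y ≟ c} (from T-≡ coloured))
      (λ (y∈ns , ℓy≡c) → verts-complete y ,
        trans (cong₂ _∧_ (from (adj⇔∈ y) y∈ns) (isYes≗does (ℓ y ≟ c))) (dec-true (ℓ y ≟ c) ℓy≡c))

  balanced-at⇔ : Unique verts → (∀ y → y ∈ verts) →
                 ∀ {x ns} → Unique ns → (∀ y → adj x y ≡ true ⇔ y ∈ ns) →
                 ∀ ℓ → (∀ c c' → nbrCount G ℓ x c ≡ nbrCount G ℓ x c') ⇔ Balanced (map ℓ ns)
  balanced-at⇔ verts-unique verts-complete {x} {ns} ns-unique adj⇔∈ ℓ = mk⇔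
    (λ bal c c' → trans (sym (count c)) (trans (bal c c') (count c')))
    (λ bal c c' → trans (count c) (trans (bal c c') (sym (count c'))))
    where
    count : ∀ c → nbrCount G ℓ x c ≡ occ c (map ℓ ns)
    count = nbrCount≡occ verts-unique verts-complete ns-unique adj⇔∈ ℓ

≡ᵇ[mod]⇔ : ∀ {m} .{{_ : NonZero m}} {x y} → (x ≡ᵇ y [mod m ]) ≡ true ⇔ x % m ≡ y % m
≡ᵇ[mod]⇔ {suc _} = mk⇔ (λ e → ℕ.≡ᵇ⇒≡ _ _ (from T-≡ e)) (λ e → to T-≡ (ℕ.≡⇒≡ᵇ _ _ e))

module Cyclic (m : ℕ) .{{_ : NonZero m}} where

  infixl 6 _⊕_ _⊖_

  _⊕_ : Fin m → ℕ → Fin m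
  a ⊕ d = (toℕ a + d) mod m

  _⊖_ : Fin m → ℕ → Fin m
  a ⊖ d = a ⊕ (m ∸ d)

  mod-toℕ : ∀ a → toℕ a mod m ≡ a
  mod-toℕ a = toℕ-injective (trans (toℕ-mod (toℕ a) m) (m<n⇒m%n≡m (toℕ<n a)))

  %≡⇔≡mod : ∀ {b n} → toℕ b % m ≡ n % m ⇔ b ≡ n mod m
  %≡⇔≡mod {b} {n} = mk⇔
    (λ e → toℕ-injective (trans (sym (m<n⇒m%n≡m (toℕ<n b))) (trans e (sym (toℕ-mod n m)))))
    (λ b≡ → trans (cong (λ i → toℕ i % m) b≡) (trans (cong (_% m) (toℕ-mod n m)) (m%n%n≡m%n n m)))

  mod-+m : ∀ n → (n + m) mod m ≡ n mod m
  mod-+m n = to %≡⇔≡mod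
    (trans (cong (_% m) (toℕ-mod (n + m) m)) (trans (m%n%n≡m%n _ m) ([m+n]%n≡m%n n m)))

  mod-⊕ : ∀ n d → n mod m ⊕ d ≡ (n + d) mod m
  mod-⊕ n d = to %≡⇔≡mod (begin
    toℕ (n mod m ⊕ d) % m    ≡⟨ m<n⇒m%n≡m (toℕ<n (n mod m ⊕ d)) ⟩
    toℕ (n mod m ⊕ d)        ≡⟨ toℕ-mod _ m ⟩
    (toℕ (n mod m) + d) % m  ≡⟨ cong (λ i → (i + d) % m) (toℕ-mod n m) ⟩
    (n % m + d) % m          ≡⟨ %-distribˡ-+ (n % m) d m ⟩
    (n % m % m + d % m) % m  ≡⟨ cong (λ i → (i + d % m) % m) (m%n%n≡m%n n m) ⟩
    (n % m + d % m) % m      ≡⟨ %-distribˡ-+ n d m ⟨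
    (n + d) % m              ∎)
    where open ≡-Reasoning

  mod-⊖ : ∀ n {d} → d ≤ m → (n + d) mod m ⊖ d ≡ n mod m
  mod-⊖ n {d} d≤m = trans (mod-⊕ (n + d) (m ∸ d))
    (trans (cong (_mod m) (trans (ℕ.+-assoc n d (m ∸ d)) (cong (n +_) (ℕ.m+[n∸m]≡n d≤m)))) (mod-+m n))

  ⊕-⊕ : ∀ a d e → a ⊕ d ⊕ e ≡ a ⊕ (d + e)
  ⊕-⊕ a d e = trans (mod-⊕ (toℕ a + d) e) (cong (_mod m) (ℕ.+-assoc (toℕ a) d e))

  ⊕-m : ∀ a → a ⊕ m ≡ a
  ⊕-m a = trans (mod-+m (toℕ a)) (mod-toℕ a)

  ⊖-⊕ : ∀ {d} → d ≤ m → ∀ a → a ⊖ d ⊕ d ≡ a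
  ⊖-⊕ {d} d≤m a = trans (⊕-⊕ a (m ∸ d) d) (trans (cong (a ⊕_) (ℕ.m∸n+n≡m d≤m)) (⊕-m a))

  ⊕-⊖ : ∀ {d} → d ≤ m → ∀ a → a ⊕ d ⊖ d ≡ a
  ⊕-⊖ {d} d≤m a = trans (⊕-⊕ a d (m ∸ d)) (trans (cong (a ⊕_) (ℕ.m+[n∸m]≡n d≤m)) (⊕-m a))

  ⊕≡⇔≡⊖ : ∀ {d} → d ≤ m → ∀ {a b} → b ⊕ d ≡ a ⇔ b ≡ a ⊖ d
  ⊕≡⇔≡⊖ {d} d≤m {a} {b} = mk⇔
    (λ e → trans (sym (⊕-⊖ d≤m b)) (cong (_⊖ d) e))
    (λ e → trans (cong (_⊕ d) e) (⊖-⊕ d≤m a))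

  -- a + e = (a + e) % m + q * m = a + q * m, so e = q * m.
  ⊕-no-fixpoint : ∀ {e} → 0 < e → e < m → ∀ a → a ⊕ e ≢ a
  ⊕-no-fixpoint {e} 0<e e<m a a⊕e≡a with (toℕ a + e) / m | e≡q*m
    where
    e≡q*m : e ≡ (toℕ a + e) / m * m
    e≡q*m = ℕ.+-cancelˡ-≡ (toℕ a) e _ (trans (m≡m%n+[m/n]*n (toℕ a + e) m)
      (cong (_+ (toℕ a + e) / m * m) (trans (sym (toℕ-mod _ m)) (cong toℕ a⊕e≡a))))
  ... | zero  | e≡0        = ℕ.<⇒≢ 0<e (sym e≡0)
  ... | suc q | e≡[1+q]*m = ℕ.<⇒≱ e<m (subst (m ≤_) (sym e≡[1+q]*m) (ℕ.m≤m+n m (q * m)))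

  ⊕≢⊖ : ∀ {d} → 0 < d → d + d < m → ∀ a → a ⊕ d ≢ a ⊖ d
  ⊕≢⊖ {d} 0<d d+d<m a eq = ⊕-no-fixpoint (ℕ.<-≤-trans 0<d (ℕ.m≤m+n d d)) d+d<m a
    (trans (sym (⊕-⊕ a d d)) (trans (cong (_⊕ d) eq) (⊖-⊕ d≤m a)))
    where
    d≤m : d ≤ m
    d≤m = ℕ.<⇒≤ (ℕ.≤-<-trans (ℕ.m≤m+n d d) d+d<m)

  ν-⊕ : 3 ∣ m → ∀ a d → ν (toℕ (a ⊕ d)) ≡ ν (toℕ a) +₃ ν d
  ν-⊕ 3∣m a d = trans ν[a⊕d]≡ (ν-+ (toℕ a) d)
    where
    ν[a⊕d]≡ : ν (toℕ (a ⊕ d)) ≡ ν (toℕ a + d)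
    ν[a⊕d]≡ = toℕ-injective (trans (toℕ-mod (toℕ (a ⊕ d)) 3)
      (trans (cong (_% 3) (toℕ-mod (toℕ a + d) m))
        (trans (m∣n⇒o%n%m≡o%m 3 m _ 3∣m) (sym (toℕ-mod (toℕ a + d) 3)))))

  rainbow-⊕⊖ : 3 ∣ m → ∀ {d} → d ≤ m → ¬ 3 ∣ d → ∀ a →
               Rainbow (ν (toℕ (a ⊕ d))) (ν (toℕ (a ⊖ d))) (ν (toℕ a))
  rainbow-⊕⊖ 3∣m {d} d≤m 3∤d a = rainbow-subst
    (rainbow-translate (ν (toℕ a)) (ν d) (ν (m ∸ d)) (3∤d ∘ to (ν≡0⇔3∣ d)) ν[d+[m∸d]]≡0)
    (sym (ν-⊕ 3∣m a d)) (sym (ν-⊕ 3∣m a (m ∸ d))) refl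
    where
    ν[d+[m∸d]]≡0 : ν d +₃ ν (m ∸ d) ≡ 0F
    ν[d+[m∸d]]≡0 = trans (sym (ν-+ d (m ∸ d)))
      (from (ν≡0⇔3∣ _) (subst (3 ∣_) (sym (ℕ.m+[n∸m]≡n d≤m)) 3∣m))

pattern V = 0F
pattern U = 1F
pattern W = 2F

module Pappus {m j k : ℕ} .{{_ : NonZero m}}
  (3≤m : 3 ≤ m) (0<j : 0 < j) (j+j<m : j + j < m) (k+k≤m : k + k ≤ m) where

  open Cyclic m
  open FinGraph (pappus m j k) using (verts; adj)

  private
    1≤m : 1 ≤ m
    1≤m = ℕ.≤-trans (s≤s z≤n) 3≤m
    j≤m : j ≤ m
    j≤m = ℕ.<⇒≤ (ℕ.≤-<-trans (ℕ.m≤m+n j j) j+j<m)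
    k≤m : k ≤ m
    k≤m = ℕ.≤-trans (ℕ.m≤m+n k k) k+k≤m

  step⇔ : ∀ a b d → (toℕ b ≡ᵇ toℕ a + d [mod m ]) ≡ true ⇔ b ≡ a ⊕ d
  step⇔ a b d = ⇔.trans ≡ᵇ[mod]⇔ %≡⇔≡mod

  back⇔ : ∀ a b {d} → d ≤ m → (toℕ a ≡ᵇ toℕ b + d [mod m ]) ≡ true ⇔ b ≡ a ⊖ d
  back⇔ a b {d} d≤m = ⇔.trans (step⇔ b a d) (⇔.trans (mk⇔ sym sym) (⊕≡⇔≡⊖ d≤m))

  same⇔ : ∀ a b → (toℕ b ≡ᵇ toℕ a [mod m ]) ≡ true ⇔ b ≡ a
  same⇔ a b = ⇔.trans ≡ᵇ[mod]⇔
    (⇔.trans %≡⇔≡mod (mk⇔ (λ e → trans e (mod-toℕ a)) (λ e → trans e (sym (mod-toℕ a)))))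

  neighbours : PVertex m → List (PVertex m)
  neighbours (V , a) = (V , a ⊕ 1) ∷ (V , a ⊖ 1) ∷ (U , a) ∷ []
  neighbours (U , a) = (W , a ⊕ j) ∷ (W , a ⊖ j) ∷ (V , a) ∷ []
  neighbours (W , a) = (U , a ⊕ j) ∷ (U , a ⊖ j) ∷ (W , a ⊕ k) ∷ (W , a ⊖ k) ∷ []

  -- Valid when k + k ≡ m, so that w_{a+k} = w_{a-k}.
  cubic-neighbours : PVertex m → List (PVertex m)
  cubic-neighbours (W , a) = (U , a ⊕ j) ∷ (U , a ⊖ j) ∷ (W , a ⊕ k) ∷ []
  cubic-neighbours x       = neighbours x

  adj⇒∈neighbours : ∀ x y → adj x y ≡ true → y ∈ neighbours x
  adj⇒∈neighbours (V , a) (V , b) e with toℕ b ≡ᵇ toℕ a + 1 [mod m ] in e₁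
  ... | true  = here (cong (V ,_) (to (step⇔ a b 1) e₁))
  ... | false = there (here (cong (V ,_) (to (back⇔ a b 1≤m) e)))
  adj⇒∈neighbours (V , a) (U , b) e with toℕ b ≡ᵇ toℕ a [mod m ] in e₁
  ... | true  = there (there (here (cong (U ,_) (to (same⇔ a b) e₁))))
  adj⇒∈neighbours (V , a) (W , b) ()
  adj⇒∈neighbours (U , a) (V , b) e = there (there (here (cong (V ,_) (sym (to (same⇔ b a) e)))))
  adj⇒∈neighbours (U , a) (U , b) ()
  adj⇒∈neighbours (U , a) (W , b) e with toℕ b ≡ᵇ toℕ a + j [mod m ] in e₁
  ... | true  = here (cong (W ,_) (to (step⇔ a b j) e₁))
  ... | false with toℕ a ≡ᵇ toℕ b + j [mod m ] in e₂
  ...   | true = there (here (cong (W ,_) (to (back⇔ a b j≤m) e₂)))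
  adj⇒∈neighbours (W , a) (V , b) ()
  adj⇒∈neighbours (W , a) (U , b) e with toℕ b ≡ᵇ toℕ a + j [mod m ] in e₁
  ... | true  = here (cong (U ,_) (to (step⇔ a b j) e₁))
  ... | false = there (here (cong (U ,_) (to (back⇔ a b j≤m) (trans (sym (∨-identityʳ _)) e))))
  adj⇒∈neighbours (W , a) (W , b) e with toℕ b ≡ᵇ toℕ a + k [mod m ] in e₁
  ... | true  = there (there (here (cong (W ,_) (to (step⇔ a b k) e₁))))
  ... | false = there (there (there (here (cong (W ,_) (to (back⇔ a b k≤m) e)))))

  ∈neighbours⇒adj : ∀ x y → y ∈ neighbours x → adj x y ≡ true
  ∈neighbours⇒adj (V , a) _ (here refl)                 = ∨-≡-trueˡ _ (from (step⇔ a _ 1) refl)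
  ∈neighbours⇒adj (V , a) _ (there (here refl))         = ∨-≡-trueʳ _ (from (back⇔ a _ 1≤m) refl)
  ∈neighbours⇒adj (V , a) _ (there (there (here refl))) = ∨-≡-trueˡ _ (from (same⇔ a a) refl)
  ∈neighbours⇒adj (U , a) _ (here refl)                 = ∨-≡-trueˡ _ (∨-≡-trueˡ _ (from (step⇔ a _ j) refl))
  ∈neighbours⇒adj (U , a) _ (there (here refl))         =
    ∨-≡-trueˡ _ (∨-≡-trueʳ (toℕ (a ⊖ j) ≡ᵇ toℕ a + j [mod m ]) (from (back⇔ a _ j≤m) refl))
  ∈neighbours⇒adj (U , a) _ (there (there (here refl))) = from (same⇔ a a) refl
  ∈neighbours⇒adj (W , a) _ (here refl)                 = ∨-≡-trueʳ _ (from (step⇔ a _ j) refl)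
  ∈neighbours⇒adj (W , a) _ (there (here refl))         = ∨-≡-trueˡ _ (from (back⇔ a _ j≤m) refl)
  ∈neighbours⇒adj (W , a) _ (there (there (here refl))) = ∨-≡-trueˡ _ (from (step⇔ a _ k) refl)
  ∈neighbours⇒adj (W , a) _ (there (there (there (here refl)))) = ∨-≡-trueʳ _ (from (back⇔ a _ k≤m) refl)

  adj⇔∈neighbours : ∀ x y → adj x y ≡ true ⇔ y ∈ neighbours x
  adj⇔∈neighbours x y = mk⇔ (adj⇒∈neighbours x y) (∈neighbours⇒adj x y)

  adj⇔∈cubic-neighbours : k + k ≡ m → ∀ x y → adj x y ≡ true ⇔ y ∈ cubic-neighbours x
  adj⇔∈cubic-neighbours k+k≡m (V , a) y = adj⇔∈neighbours (V , a) y
  adj⇔∈cubic-neighbours k+k≡m (U , a) y = adj⇔∈neighbours (U , a) y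
  adj⇔∈cubic-neighbours k+k≡m (W , a) y =
    ⇔.trans (adj⇔∈neighbours (W , a) y) (∈-dedup (cong (λ d → W , a ⊕ d) m∸k≡k))
    where
    m∸k≡k : m ∸ k ≡ k
    m∸k≡k = trans (cong (_∸ k) (sym k+k≡m)) (ℕ.m+n∸n≡m k k)

  cubic-neighbours-unique : ∀ x → Unique (cubic-neighbours x)
  cubic-neighbours-unique (V , a) = unique₃ (⊕≢⊖ (s≤s z≤n) 3≤m a ∘ cong proj₂) (λ ()) (λ ())
  cubic-neighbours-unique (U , a) = unique₃ (⊕≢⊖ 0<j j+j<m a ∘ cong proj₂) (λ ()) (λ ())
  cubic-neighbours-unique (W , a) = unique₃ (⊕≢⊖ 0<j j+j<m a ∘ cong proj₂) (λ ()) (λ ())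

  W-neighbours-unique : 0 < k → k + k < m → ∀ a → Unique (neighbours (W , a))
  W-neighbours-unique 0<k k+k<m a = unique₄
    (⊕≢⊖ 0<j j+j<m a ∘ cong proj₂) (λ ()) (λ ()) (λ ()) (λ ()) (⊕≢⊖ 0<k k+k<m a ∘ cong proj₂)

  verts-unique : Unique verts
  verts-unique = cartesianProduct⁺ (allFin⁺ 3) (allFin⁺ m)

  verts-complete : ∀ y → y ∈ verts
  verts-complete (t , a) = ∈-cartesianProduct⁺ (∈-allFin t) (∈-allFin a)

  cubic-balanced-at⇔ : k + k ≡ m → ∀ ℓ x →
    (∀ c c' → nbrCount (pappus m j k) ℓ x c ≡ nbrCount (pappus m j k) ℓ x c') ⇔
    Balanced (map ℓ (cubic-neighbours x))
  cubic-balanced-at⇔ k+k≡m ℓ x = balanced-at⇔ (pappus m j k) verts-unique verts-complete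
    (cubic-neighbours-unique x) (adj⇔∈cubic-neighbours k+k≡m x) ℓ

  -- w_a has four distinct neighbours, and 3 ∤ 4.
  k+k<m⇒¬threeBalanced : 0 < k → k + k < m → ¬ ThreeBalanced (pappus m j k)
  k+k<m⇒¬threeBalanced 0<k k+k<m (ℓ , bal) = from-no (3 ∣? 4) (balanced⇒3∣length {map ℓ (neighbours w₀)}
    (to (balanced-at⇔ (pappus m j k) verts-unique verts-complete
          (W-neighbours-unique 0<k k+k<m (0 mod m)) (adj⇔∈neighbours w₀) ℓ) (bal w₀)))
    where
    w₀ : PVertex m
    w₀ = W , 0 mod m

  threeBalanced⇒3∣k×3∤j : k + k ≡ m → ThreeBalanced (pappus m j k) → 3 ∣ k × ¬ 3 ∣ j
  threeBalanced⇒3∣k×3∤j k+k≡m (ℓ , bal) = Constraints.3∣k , Constraints.3∤j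
    where
    colours : Fin 3 → ℕ → Fin 3
    colours t n = ℓ (t , n mod m)
    periodic : ∀ t → Periodic (k + k) (colours t)
    periodic t n = cong (λ i → ℓ (t , i)) (trans (cong (λ p → (n + p) mod m) k+k≡m) (mod-+m n))
    balanced-at : ∀ t i → Balanced (map ℓ (cubic-neighbours (t , i)))
    balanced-at t i = to (cubic-balanced-at⇔ k+k≡m ℓ (t , i)) (bal (t , i))
    shift : ∀ t n d → ℓ (t , n mod m ⊕ d) ≡ colours t (n + d)
    shift t n d = cong (λ i → ℓ (t , i)) (mod-⊕ n d)
    unshift : ∀ t n {d} → d ≤ m → ℓ (t , (n + d) mod m ⊖ d) ≡ colours t n
    unshift t n d≤m = cong (λ i → ℓ (t , i)) (mod-⊖ n d≤m)
    module Constraints = RainbowConstraints (periodic V) (periodic U) (periodic W)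
      (subst (j + j ≤_) (sym k+k≡m) (ℕ.<⇒≤ j+j<m))
      (λ n → rainbow-subst (balanced⇒rainbow _ _ _ (balanced-at V ((n + 1) mod m)))
        (trans (shift V (n + 1) 1) (cong (colours V) (ℕ.+-assoc n 1 1))) (unshift V n 1≤m) refl)
      (λ n → rainbow-subst (balanced⇒rainbow _ _ _ (balanced-at U ((n + j) mod m)))
        (shift W (n + j) j) (unshift W n j≤m) refl)
      (λ n → rainbow-subst (balanced⇒rainbow _ _ _ (balanced-at W ((n + j) mod m)))
        (shift U (n + j) j) (unshift U n j≤m) (shift W (n + j) k))

  3∣k×3∤j⇒threeBalanced : k + k ≡ m → 3 ∣ m → 3 ∣ k → ¬ 3 ∣ j → ThreeBalanced (pappus m j k)
  3∣k×3∤j⇒threeBalanced k+k≡m 3∣m 3∣k 3∤j =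
    colour , λ x → from (cubic-balanced-at⇔ k+k≡m colour x) (balanced x)
    where
    colour : PVertex m → Fin 3
    colour (_ , a) = ν (toℕ a)
    ν[a⊕k]≡ν[a] : ∀ a → ν (toℕ (a ⊕ k)) ≡ ν (toℕ a)
    ν[a⊕k]≡ν[a] a = trans (ν-⊕ 3∣m a k)
      (trans (cong (ν (toℕ a) +₃_) (from (ν≡0⇔3∣ k) 3∣k)) (+₃-identityʳ _))
    balanced : ∀ x → Balanced (map colour (cubic-neighbours x))
    balanced (V , a) = rainbow⇒balanced _ _ _ (rainbow-⊕⊖ 3∣m 1≤m (from-no (3 ∣? 1)) a)
    balanced (U , a) = rainbow⇒balanced _ _ _ (rainbow-⊕⊖ 3∣m j≤m 3∤j a)
    balanced (W , a) = rainbow⇒balanced _ _ _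
      (rainbow-subst (rainbow-⊕⊖ 3∣m j≤m 3∤j a) refl refl (sym (ν[a⊕k]≡ν[a] a)))

theorem5p6 : (m j k : ℕ) → 4 ≤ m → 1 ≤ j → 2 * j < m → 1 ≤ k → 2 * k ≤ m →
    (ThreeBalanced (pappus m j k) ⇔ (6 ∣ m × ¬ (3 ∣ j) × 2 * k ≡ m))
theorem5p6 m j k 4≤m 1≤j 2j<m 1≤k 2k≤m = mk⇔ necessary sufficient
  where
  instance
    m≢0 : NonZero m
    m≢0 = >-nonZero (ℕ.<-≤-trans (s≤s z≤n) 4≤m)
  2*≡+ : ∀ n → 2 * n ≡ n + n
  2*≡+ n = cong (n +_) (ℕ.+-identityʳ n)
  k+k≤m : k + k ≤ m
  k+k≤m = subst (_≤ m) (2*≡+ k) 2k≤m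
  open Pappus {m} {j} {k} (ℕ.≤-trans (ℕ.n≤1+n 3) 4≤m) 1≤j (subst (_< m) (2*≡+ j) 2j<m) k+k≤m
  necessary : ThreeBalanced (pappus m j k) → 6 ∣ m × ¬ 3 ∣ j × 2 * k ≡ m
  necessary balanced with ℕ.m≤n⇒m<n∨m≡n k+k≤m
  ... | inj₁ k+k<m = ⊥-elim (k+k<m⇒¬threeBalanced 1≤k k+k<m balanced)
  ... | inj₂ k+k≡m = let 3∣k , 3∤j = threeBalanced⇒3∣k×3∤j k+k≡m balanced
    in subst (6 ∣_) k+k≡m (to (3∣k⇔6∣k+k k) 3∣k) , 3∤j , trans (2*≡+ k) k+k≡m
  sufficient : 6 ∣ m × ¬ 3 ∣ j × 2 * k ≡ m → ThreeBalanced (pappus m j k)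
  sufficient (6∣m , 3∤j , 2k≡m) = 3∣k×3∤j⇒threeBalanced k+k≡m (∣-trans (divides 2 refl) 6∣m)
    (from (3∣k⇔6∣k+k k) (subst (6 ∣_) (sym k+k≡m) 6∣m)) 3∤j
    where
    k+k≡m : k + k ≡ m
    k+k≡m = trans (sym (2*≡+ k)) 2k≡m
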